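{- Let $\mathcal{N}$ be a (possibly infinite) near hexagon with exactly three points on each line, and let $\mathcal{H}$ be a full proper subgeometry of $\mathcal{N}$ isomorphic to $H^D(2)$ and isometrically embedded in $\mathcal{N}$. If $L=\{x_1,x_2,x_3\}$ is a line of $\mathcal{N}$, then $f_{x_1},f_{x_2},f_{x_3}$ are mutually distinct, and hence $\{f_{x_1},f_{x_2},f_{x_3}\}$ is a line of the valuation geometry $\mathcal{V}$ of $\mathcal{H}$.
   Context: A near hexagon is a partial linear space whose collinearity graph is connected of diameter $3$ such that for every point $x$ and line $L$ there is a unique point on $L$ nearest to $x$. Full: every point of $\mathcal{N}$ on a line of $\mathcal{H}$ lies in $\mathcal{H}$; isometrically embedded: distances agree. $H^D(2)$ is the point-line dual of the split Cayley hexagon of order $2$. A valuation of $\mathcal{H}$ is a map $f$ from the point set of $\mathcal{H}$ to $\mathbb{Z}$ with minimum value $0$ such that each line has a unique point of minimal $f$-value and its other points have $f$-value one larger. For a point $x$ of $\mathcal{N}$, $f_x(y)=\mathrm{d}(x,y)-\mathrm{d}(x,\mathcal{H})$. Valuations $f_1,f_2$ are neighboring if there is $\epsilon\in\mathbb{Z}$ with $|f_1(y)-f_2(y)+\epsilon|\le 1$ for all $y$; then $f_1\ast f_2$ is defined as $f_3'-\min f_3'$, where $f_3'(y)=f_1(y)-1$ if $f_1(y)=f_2(y)-\epsilon$ and $f_3'(y)=\max\{f_1(y),f_2(y)-\epsilon\}$ otherwise. The valuation geometry $\mathcal{V}$ has as points the valuations of $\mathcal{H}$ and as lines the triples $\{f_1,f_2,f_3\}$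 of mutually distinct valuations with $f_1,f_2$ neighboring and $f_3=f_1\ast f_2$. -}

module Defs where

open import Data.Bool using (Bool; true; false; _∧_; _xor_; not; T; if_then_else_)
open import Data.Bool.Properties using (T?)
open import Data.Nat as ℕ using (ℕ; zero; suc; _<ᵇ_)
open import Data.Fin using (Fin; #_)
open import Data.Vec using (Vec; lookup; zipWith; []; _∷_)
open import Data.List as List using (List; []; _∷_; concatMap; mapMaybe)
open import Data.Maybe using (Maybe; just; nothing)
open import Data.Integer as ℤ using (ℤ; +_)
open import Data.Product using (Σ; ∃; _×_; _,_; proj₁; proj₂)
open import Data.Sum using (_⊎_)
open import Relation.Binary.PropositionalEquality using (_≡_; _≢_; _≗_)
open import Relation.Nullary using (¬_; yes; no; does)

module Geometry {P L : Set} (_I_ : P → L → Set) where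

  data Walk : P → P → ℕ → Set where
    here : ∀ {x} → Walk x x 0
    step : ∀ {x y z n} (l : L) → x ≢ y → x I l → y I l →
           Walk y z n → Walk x z (suc n)

  Dist : P → P → ℕ → Set
  Dist x y n = Walk x y n × (∀ m → m ℕ.< n → ¬ Walk x y m)

record NearHexagon3 : Set₁ where
  field
    Pt  : Set
    Ln  : Set
    _I_ : Pt → Ln → Set
    three : ∀ l → Σ Pt λ a → Σ Pt λ b → Σ Pt λ c →
              a I l × b I l × c I l × a ≢ b × a ≢ c × b ≢ c ×
              (∀ z → z I l → z ≡ a ⊎ (z ≡ b ⊎ z ≡ c))
    partialLinear : ∀ {x y l m} → x ≢ y → x I l → y I l → x I m → y I m → l ≡ m
    diam  : ∀ x y → Σ ℕ λ n → n ℕ.≤ 3 × Geometry.Dist _I_ x y n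
    diam3 : Σ Pt λ x → Σ Pt λ y → Geometry.Dist _I_ x y 3
    nearest : ∀ x l → Σ Pt λ y → y I l ×
                (∀ z → z I l → z ≢ y → ∀ m n →
                  Geometry.Dist _I_ x y m → Geometry.Dist _I_ x z n → m ℕ.< n)

  d : Pt → Pt → ℕ
  d x y = proj₁ (diam x y)

-- The split Cayley hexagon H(2) and its dual H^D(2)
-- PG(6,2): nonzero vectors (X0,...,X6) of F_2^7 (F_2 = Bool, + = xor, * = ∧)

Vec7 : Set
Vec7 = Vec Bool 7

_⊕_ : Vec7 → Vec7 → Vec7
_⊕_ = zipWith _xor_

_==_ : Bool → Bool → Bool
x == y = not (x xor y)

nonzero : ∀ {n} → Vec Bool n → Bool
nonzero [] = false
nonzero (true ∷ v) = true
nonzero (false ∷ v) = nonzero v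

-- binary code of a vector (used only to pick a canonical representative)
code : ∀ {n} → Vec Bool n → ℕ
code [] = 0
code (b ∷ v) = (if b then 1 else 0) ℕ.+ 2 ℕ.* code v

quadric : Vec7 → Bool
quadric (x0 ∷ x1 ∷ x2 ∷ x3 ∷ x4 ∷ x5 ∷ x6 ∷ []) =
  ((x0 ∧ x4) xor (x1 ∧ x5) xor (x2 ∧ x6)) == (x3 ∧ x3)

-- Grassmann coordinate p_ij of the line spanned by a and b
pl : Vec7 → Vec7 → Fin 7 → Fin 7 → Bool
pl a b i j = (lookup a i ∧ lookup b j) xor (lookup a j ∧ lookup b i)

grassmannOK : Vec7 → Vec7 → Bool
grassmannOK a b =
  (pl a b (# 1) (# 2) == pl a b (# 3) (# 4)) ∧
  (pl a b (# 5) (# 4) == pl a b (# 3) (# 2)) ∧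
  (pl a b (# 2) (# 0) == pl a b (# 3) (# 5)) ∧
  (pl a b (# 6) (# 5) == pl a b (# 3) (# 0)) ∧
  (pl a b (# 0) (# 1) == pl a b (# 3) (# 6)) ∧
  (pl a b (# 4) (# 6) == pl a b (# 3) (# 1))

isH2Point : Vec7 → Bool
isH2Point v = nonzero v ∧ quadric v

H2Point : Set
H2Point = Σ Vec7 λ v → T (isH2Point v)

-- lines of H(2): lines {a, b, a+b} of Q(6,2) satisfying the Grassmann
-- conditions; represented canonically by (a,b) with code a < code b < code (a+b)
isH2Line : Vec7 → Vec7 → Bool
isH2Line a b =
  nonzero a ∧ (code a <ᵇ code b) ∧ (code b <ᵇ code (a ⊕ b)) ∧
  quadric a ∧ quadric b ∧ quadric (a ⊕ b) ∧ grassmannOK a b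

H2Line : Set
H2Line = Σ (Vec7 × Vec7) λ ab → T (isH2Line (proj₁ ab) (proj₂ ab))

_I₂_ : H2Point → H2Line → Set
(v , _) I₂ ((a , b) , _) = v ≡ a ⊎ (v ≡ b ⊎ v ≡ a ⊕ b)

HDPoint : Set
HDPoint = H2Line

HDLine : Set
HDLine = H2Point

_Iᴰ_ : HDPoint → HDLine → Set
p Iᴰ l = l I₂ p

allVecs : ∀ n → List (Vec Bool n)
allVecs zero = [] ∷ []
allVecs (suc n) = concatMap (λ v → (false ∷ v) ∷ (true ∷ v) ∷ []) (allVecs n)

selectHD : Vec7 × Vec7 → Maybe HDPoint
selectHD (a , b) with T? (isH2Line a b)
... | yes t = just ((a , b) , t)
... | no _  = nothing

allHDPoints : List HDPoint
allHDPoints =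
  mapMaybe selectHD (concatMap (λ a → List.map (λ b → (a , b)) (allVecs 7)) (allVecs 7))

minOver : (HDPoint → ℤ) → ℤ
minOver f with List.map f allHDPoints
... | [] = + 0
... | z ∷ zs = List.foldr ℤ._⊓_ z zs

record IsValuation (f : HDPoint → ℤ) : Set where
  field
    nonneg  : ∀ p → + 0 ℤ.≤ f p
    hasZero : Σ HDPoint λ p → f p ≡ + 0
    lineMin : ∀ l → Σ HDPoint λ p → p Iᴰ l ×
                (∀ q → q Iᴰ l → q ≢ p → f q ≡ f p ℤ.+ + 1)

Neighboring : (HDPoint → ℤ) → (HDPoint → ℤ) → ℤ → Set
Neighboring f g ε = ∀ p → ℤ.∣ f p ℤ.- g p ℤ.+ ε ∣ ℕ.≤ 1

star' : (HDPoint → ℤ) → (HDPoint → ℤ) → ℤ → HDPoint → ℤ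
star' f g ε y =
  if does (f y ℤ.≟ (g y ℤ.- ε)) then f y ℤ.- + 1 else f y ℤ.⊔ (g y ℤ.- ε)

star : (HDPoint → ℤ) → (HDPoint → ℤ) → ℤ → HDPoint → ℤ
star f g ε y = star' f g ε y ℤ.- minOver (star' f g ε)

VLineOrd : (HDPoint → ℤ) → (HDPoint → ℤ) → (HDPoint → ℤ) → Set
VLineOrd f₁ f₂ f₃ =
  IsValuation f₁ × IsValuation f₂ × IsValuation f₃ ×
  ¬ (f₁ ≗ f₂) × ¬ (f₁ ≗ f₃) × ¬ (f₂ ≗ f₃) ×
  Σ ℤ λ ε → Neighboring f₁ f₂ ε × (f₃ ≗ star f₁ f₂ ε)

IsVLine : (HDPoint → ℤ) → (HDPoint → ℤ) → (HDPoint → ℤ) → Set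
IsVLine f g h =
  VLineOrd f g h ⊎ (VLineOrd f h g ⊎ (VLineOrd g f h ⊎
  (VLineOrd g h f ⊎ (VLineOrd h f g ⊎ VLineOrd h g f))))

-- A full, proper, isometrically embedded subgeometry H of N isomorphic to
-- H^D(2), given by an isomorphism (φ, ψ) of H^D(2) onto H

module _ (N : NearHexagon3) where
  open NearHexagon3 N

  record HDEmbedding : Set where
    field
      φ : HDPoint → Pt
      ψ : HDLine → Ln
      φ-inj : ∀ {p q} → φ p ≡ φ q → p ≡ q
      ψ-inj : ∀ {l m} → ψ l ≡ ψ m → l ≡ m
      incidence : ∀ p l → (p Iᴰ l → φ p I ψ l) × (φ p I ψ l → p Iᴰ l)
      full : ∀ l x → x I ψ l → Σ HDPoint λ p → φ p ≡ x
      isometric : ∀ p q n →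
        (Geometry.Dist _Iᴰ_ p q n → Geometry.Dist _I_ (φ p) (φ q) n) ×
        (Geometry.Dist _I_ (φ p) (φ q) n → Geometry.Dist _Iᴰ_ p q n)
      proper : Σ Pt λ x → ∀ p → φ p ≢ x

    fval : Pt → HDPoint → ℤ
    fval x p = + d x (φ p) ℤ.- minOver (λ q → + d x (φ q))

-- For a point x of N and a line of N, the distances from x to the three points of the line are
-- n, n + 1, n + 1 in some order (nearest-point property).  As H is full and isometrically
-- embedded, f_x is a valuation of H, and for the points x₁, x₂, x₃ of a line, at every point of
-- H the value of f_{x₃} is obtained from those of f_{x₁} and f_{x₂} − ε, ε = d(x₁,H) − d(x₂,H),
-- by the rule defining f_{x₁} ∗ f_{x₂}.
--
-- If f_x = f_y for distinct points x, y of the line, then d(x,·) − d(y,·) is constant on H, so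
-- the same point w of the line is strictly closer than some other point of the line to every
-- point of H; all distances being at most 3, w is at distance at most 2 from all of H.  That is
-- impossible.  Let p be a point of H nearest to w.  If d(w,p) = 0, then w = p and some point of
-- H is opposite p.  If d(w,p) ≥ 2, all points of H are at distance 2 from w, contradicting the
-- pattern on a line of H.  If d(w,p) = 1, every point opposite p is at distance 2 from w, so the
-- third point of a line through two points opposite p is at distance 1 from w; but H^D(2)
-- contains two opposite such third points, as is checked by computation.
module Submission where

open import Defs
open import Data.Bool using (Bool; true; false; T; if_then_else_)
import Data.Bool as Bool
open import Data.Bool.Properties using (T?; T-irrelevant)
open import Data.Empty using (⊥; ⊥-elim)
open import Data.Fin as Fin using (Fin; zero; suc)
open import Data.Fin.Properties using (pigeonhole)
open import Data.Integer as ℤ using (ℤ; +_; -_; _-_; -1ℤ; 0ℤ; 1ℤ; _⊖_; _⊓_; ∣_∣)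
import Data.Integer.Properties as ℤ
open import Data.Integer.Tactic.RingSolver using (solve-∀)
open import Data.List using (List; []; _∷_; concatMap; foldr; map; mapMaybe)
open import Data.List.Membership.Propositional using (_∈_; lose)
open import Data.List.Membership.Propositional.Properties using (∈-map⁺; ∈-map⁻; ∈-concatMap⁺; foldr-selective)
open import Data.List.Properties using (foldr-preservesᵒ)
open import Data.List.Relation.Unary.All as All using (All; []; _∷_)
open import Data.List.Relation.Unary.Any as Any using (Any; here; there; any?)
open import Data.List.Relation.Unary.Any.Properties using (map⁺; mapMaybe⁺)
open import Data.Maybe using (Maybe)
import Data.Maybe.Relation.Unary.Any as Maybe
open import Data.Nat using (ℕ; zero; suc; _+_; _≤_; _<_; z≤n; s≤s; s≤s⁻¹; _≤?_; _%_; _/_; _≡ᵇ_)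
open import Data.Nat.Properties
open import Data.Product using (Σ; Σ-syntax; ∃₂; _×_; _,_; proj₁; proj₂)
import Data.Product.Properties as Product
open import Data.Sum using (_⊎_; inj₁; inj₂; [_,_]′)
open import Data.Vec using (Vec; []; _∷_)
import Data.Vec.Properties as Vec
open import Function using (_∘_; flip)
open import Relation.Binary.Definitions using (DecidableEquality)
open import Relation.Binary.PropositionalEquality
open import Relation.Nullary using (Dec; yes; no; does; ¬_; ¬?; _×-dec_; _⊎-dec_)
open import Relation.Nullary.Decidable using (True; toWitness; map′; dec-true; dec-false)

record ThreeOn {P L : Set} (_I_ : P → L → Set) (l : L) (x y z : P) : Set where
  constructor three-on
  field
    x∈ : x I l
    y∈ : y I l
    z∈ : z I l
    x≢y : x ≢ y
    x≢z : x ≢ z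
    y≢z : y ≢ z

module _ {P L : Set} {_I_ : P → L → Set} {l : L} {x y z : P} where

  ThreeOn-swap₂₃ : ThreeOn _I_ l x y z → ThreeOn _I_ l x z y
  ThreeOn-swap₂₃ (three-on x∈ y∈ z∈ x≢y x≢z y≢z) = three-on x∈ z∈ y∈ x≢z x≢y (y≢z ∘ sym)

  ThreeOn-rotate : ThreeOn _I_ l x y z → ThreeOn _I_ l y z x
  ThreeOn-rotate (three-on x∈ y∈ z∈ x≢y x≢z y≢z) = three-on y∈ z∈ x∈ y≢z (x≢y ∘ sym) (x≢z ∘ sym)

data LineProfile : ℕ → ℕ → ℕ → Set where
  min₁ : ∀ {n} → LineProfile n (suc n) (suc n)
  min₂ : ∀ {n} → LineProfile (suc n) n (suc n)
  min₃ : ∀ {n} → LineProfile (suc n) (suc n) n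

module _ {a b c : ℕ} where

  profile₁ : b ≡ suc a → c ≡ suc a → LineProfile a b c
  profile₁ refl refl = min₁

  profile₂ : a ≡ suc b → c ≡ suc b → LineProfile a b c
  profile₂ refl refl = min₂

  profile₃ : a ≡ suc c → b ≡ suc c → LineProfile a b c
  profile₃ refl refl = min₃

  gap : LineProfile a b c → ℤ
  gap min₁ = -1ℤ
  gap min₂ = 1ℤ
  gap min₃ = 0ℤ

  gap-correct : (P : LineProfile a b c) → + a - + b ≡ gap P
  gap-correct P = trans (ℤ.[+m]-[+n]≡m⊖n a b) (⊖-gap P)
    where
      n⊖1+n : ∀ n → n ⊖ suc n ≡ -1ℤ
      n⊖1+n zero    = refl
      n⊖1+n (suc n) = trans (ℤ.[1+m]⊖[1+n]≡m⊖n n (suc n)) (n⊖1+n n)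
      1+n⊖n : ∀ n → suc n ⊖ n ≡ 1ℤ
      1+n⊖n zero    = refl
      1+n⊖n (suc n) = trans (ℤ.[1+m]⊖[1+n]≡m⊖n (suc n) n) (1+n⊖n n)
      ⊖-gap : (P : LineProfile a b c) → a ⊖ b ≡ gap P
      ⊖-gap (min₁ {n}) = n⊖1+n n
      ⊖-gap (min₂ {n}) = 1+n⊖n n
      ⊖-gap (min₃ {n}) = ℤ.n⊖n≡0 (suc n)

  ∣gap∣≤1 : (P : LineProfile a b c) → ∣ gap P ∣ ≤ 1
  ∣gap∣≤1 min₁ = ≤-refl
  ∣gap∣≤1 min₂ = ≤-refl
  ∣gap∣≤1 min₃ = z≤n

  gap-cases : (P : LineProfile a b c) → gap P ≡ -1ℤ ⊎ gap P ≡ 1ℤ ⊎ gap P ≡ 0ℤ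
  gap-cases min₁ = inj₁ refl
  gap-cases min₂ = inj₂ (inj₁ refl)
  gap-cases min₃ = inj₂ (inj₂ refl)

  gap≡-1⇒a<b : (P : LineProfile a b c) → gap P ≡ -1ℤ → a < b
  gap≡-1⇒a<b min₁ _ = n<1+n _

  gap≡1⇒b<a : (P : LineProfile a b c) → gap P ≡ 1ℤ → b < a
  gap≡1⇒b<a min₂ _ = n<1+n _

  gap≡0⇒c<a : (P : LineProfile a b c) → gap P ≡ 0ℤ → c < a
  gap≡0⇒c<a min₃ _ = n<1+n _

LineProfile-cong : ∀ {a b c a′ b′ c′} → a ≡ a′ → b ≡ b′ → c ≡ c′ → LineProfile a b c → LineProfile a′ b′ c′
LineProfile-cong refl refl refl P = P

LineProfile-equal : ∀ {a c} → LineProfile a a c → a ≡ suc c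
LineProfile-equal min₃ = refl

merge : ℤ → ℤ → ℤ
merge i j = if does (i ℤ.≟ j) then i - 1ℤ else i ℤ.⊔ j

+n-m<+1+n-m : ∀ n m → + n - m ℤ.< + suc n - m
+n-m<+1+n-m n m = ℤ.+-monoˡ-< (- m) (ℤ.+<+ (n<1+n n))

merge-profile : ∀ {a b c} → LineProfile a b c → ∀ m → merge (+ a - m) (+ b - m) ≡ + c - m
merge-profile (min₁ {n}) m
  rewrite dec-false ((+ n - m) ℤ.≟ (+ suc n - m)) (ℤ.<⇒≢ (+n-m<+1+n-m n m)) =
    ℤ.i≤j⇒i⊔j≡j (ℤ.<⇒≤ (+n-m<+1+n-m n m))
merge-profile (min₂ {n}) m
  rewrite dec-false ((+ suc n - m) ℤ.≟ (+ n - m)) (ℤ.<⇒≢ (+n-m<+1+n-m n m) ∘ sym) =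
    ℤ.i≥j⇒i⊔j≡i (ℤ.<⇒≤ (+n-m<+1+n-m n m))
merge-profile (min₃ {n}) m
  rewrite dec-true ((+ suc n - m) ℤ.≟ (+ suc n - m)) refl = lemma (+ n) m
  where
    -- + suc n is 1ℤ ℤ.+ + n by computation
    lemma : ∀ i m → (1ℤ ℤ.+ i - m) - 1ℤ ≡ i - m
    lemma = solve-∀

shifted-difference : ∀ i j m n → (i - m) - (j - n) ℤ.+ (m - n) ≡ i - j
shifted-difference = solve-∀

shift-cancel : ∀ i m n → (i - n) - (m - n) ≡ i - m
shift-cancel = solve-∀

differences-equal : ∀ i j m n → i - m ≡ j - n → i - j ≡ m - n
differences-equal i j m n eq = begin
  i - j                         ≡⟨ sym (shifted-difference i j m n) ⟩
  (i - m) - (j - n) ℤ.+ (m - n) ≡⟨ cong (λ k → k - (j - n) ℤ.+ (m - n)) eq ⟩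
  (j - n) - (j - n) ℤ.+ (m - n) ≡⟨ cancel (j - n) (m - n) ⟩
  m - n                         ∎
  where
    open ≡-Reasoning
    cancel : ∀ k l → k - k ℤ.+ l ≡ l
    cancel = solve-∀

module NearHexagonMetric (N : NearHexagon3) where
  open NearHexagon3 N
  open Geometry _I_

  private
    variable
      x y z : Pt
      l : Ln
      m n : ℕ

  walk-∷ʳ : ∀ l → y ≢ z → y I l → z I l → Walk x y n → Walk x z (suc n)
  walk-∷ʳ l y≢z y∈ z∈ here               = step l y≢z y∈ z∈ here
  walk-∷ʳ l y≢z y∈ z∈ (step l′ ne a b w) = step l′ ne a b (walk-∷ʳ l y≢z y∈ z∈ w)

  walk-reverse : Walk x y n → Walk y x n
  walk-reverse here              = here
  walk-reverse (step l ne a b w) = walk-∷ʳ l (ne ∘ sym) b a (walk-reverse w)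

  walk-++ : Walk x y m → Walk y z n → Walk x z (m + n)
  walk-++ here              w′ = w′
  walk-++ (step l ne a b w) w′ = step l ne a b (walk-++ w w′)

  d-Dist : ∀ x y → Dist x y (d x y)
  d-Dist x y = proj₂ (proj₂ (diam x y))

  d-walk : ∀ x y → Walk x y (d x y)
  d-walk x y = proj₁ (d-Dist x y)

  d≤3 : ∀ x y → d x y ≤ 3
  d≤3 x y = proj₁ (proj₂ (diam x y))

  d≤length : Walk x y n → d x y ≤ n
  d≤length {x} {y} {n} w with d x y ≤? n
  ... | yes d≤n = d≤n
  ... | no  d≰n = ⊥-elim (proj₂ (d-Dist x y) n (≰⇒> d≰n) w)

  d-sym : ∀ x y → d x y ≡ d y x
  d-sym x y = ≤-antisym (d≤length (walk-reverse (d-walk y x))) (d≤length (walk-reverse (d-walk x y)))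

  d-triangle : ∀ x y z → d x z ≤ d x y + d y z
  d-triangle x y z = d≤length (walk-++ (d-walk x y) (d-walk y z))

  d≡0⇒≡ : d x y ≡ 0 → x ≡ y
  d≡0⇒≡ {x} {y} d≡0 = walk-length-0 (subst (Walk x y) d≡0 (d-walk x y))
    where
      walk-length-0 : Walk x y 0 → x ≡ y
      walk-length-0 here = refl

  d-collinear : x ≢ y → x I l → y I l → d x y ≡ 1
  d-collinear {x} {y} x≢y x∈ y∈ with d x y in eq | d≤length (step _ x≢y x∈ y∈ (here {y}))
  ... | zero        | _      = ⊥-elim (x≢y (d≡0⇒≡ eq))
  ... | suc zero    | _      = refl
  ... | suc (suc _) | s≤s ()

  nearest-point : ∀ x l → Σ Pt λ y → y I l × (∀ z → z I l → z ≢ y → d x z ≡ suc (d x y))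
  nearest-point x l with nearest x l
  ... | y , y∈ , closer = y , y∈ , λ z z∈ z≢y →
    ≤-antisym (begin
                d x z         ≤⟨ d-triangle x y z ⟩
                d x y + d y z ≡⟨ cong (λ k → d x y + k) (d-collinear (z≢y ∘ sym) y∈ z∈) ⟩
                d x y + 1     ≡⟨ +-comm (d x y) 1 ⟩
                suc (d x y)   ∎)
              (closer z z∈ z≢y _ _ (d-Dist x y) (d-Dist x z))
    where open ≤-Reasoning

  module _ (l : Ln) where
    private
      a b c : Pt
      a = proj₁ (three l)
      b = proj₁ (proj₂ (three l))
      c = proj₁ (proj₂ (proj₂ (three l)))
      covers : ∀ u → u I l → u ≡ a ⊎ u ≡ b ⊎ u ≡ c
      covers = proj₂ (proj₂ (proj₂ (proj₂ (proj₂ (proj₂ (proj₂ (proj₂ (proj₂ (three l)))))))))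
      index : ∀ {u} → u ≡ a ⊎ u ≡ b ⊎ u ≡ c → Fin 3
      index (inj₁ _)        = zero
      index (inj₂ (inj₁ _)) = suc zero
      index (inj₂ (inj₂ _)) = suc (suc zero)
      corner : Fin 3 → Pt
      corner zero             = a
      corner (suc zero)       = b
      corner (suc (suc zero)) = c
      corner-index : ∀ {u} (p : u ≡ a ⊎ u ≡ b ⊎ u ≡ c) → corner (index p) ≡ u
      corner-index (inj₁ p)        = sym p
      corner-index (inj₂ (inj₁ p)) = sym p
      corner-index (inj₂ (inj₂ p)) = sym p

    position-on : ∀ {u} → u I l → Fin 3
    position-on {u} u∈ = index (covers u u∈)

    position-on-injective : ∀ {u v} (u∈ : u I l) (v∈ : v I l) → position-on u∈ ≡ position-on v∈ → u ≡ v
    position-on-injective {u} {v} u∈ v∈ eq =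
      trans (sym (corner-index (covers u u∈))) (trans (cong corner eq) (corner-index (covers v v∈)))

  ThreeOn-complete : ∀ {w₁ w₂ w₃} → ThreeOn _I_ l w₁ w₂ w₃ → z I l → z ≡ w₁ ⊎ z ≡ w₂ ⊎ z ≡ w₃
  ThreeOn-complete {l} {z} {w₁} {w₂} {w₃} (three-on w₁∈ w₂∈ w₃∈ w₁≢w₂ w₁≢w₃ w₂≢w₃) z∈ =
    coincidence (pigeonhole ≤-refl (λ i → position-on l (point∈ i)))
    where
      point : Fin 4 → Pt
      point zero                   = z
      point (suc zero)             = w₁
      point (suc (suc zero))       = w₂
      point (suc (suc (suc zero))) = w₃
      point∈ : ∀ i → point i I l
      point∈ zero                   = z∈
      point∈ (suc zero)             = w₁∈
      point∈ (suc (suc zero))       = w₂∈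
      point∈ (suc (suc (suc zero))) = w₃∈
      same : ∀ i j → position-on l (point∈ i) ≡ position-on l (point∈ j) → point i ≡ point j
      same i j = position-on-injective l (point∈ i) (point∈ j)
      coincidence : (∃₂ λ i j → i Fin.< j × position-on l (point∈ i) ≡ position-on l (point∈ j)) →
                    z ≡ w₁ ⊎ z ≡ w₂ ⊎ z ≡ w₃
      coincidence (zero , j@(suc zero) , _ , eq)             = inj₁ (same zero j eq)
      coincidence (zero , j@(suc (suc zero)) , _ , eq)       = inj₂ (inj₁ (same zero j eq))
      coincidence (zero , j@(suc (suc (suc zero))) , _ , eq) = inj₂ (inj₂ (same zero j eq))
      coincidence (i@(suc zero) , j@(suc (suc zero)) , _ , eq)             = ⊥-elim (w₁≢w₂ (same i j eq))
      coincidence (i@(suc zero) , j@(suc (suc (suc zero))) , _ , eq)       = ⊥-elim (w₁≢w₃ (same i j eq))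
      coincidence (i@(suc (suc zero)) , j@(suc (suc (suc zero))) , _ , eq) = ⊥-elim (w₂≢w₃ (same i j eq))
      coincidence (suc zero , suc zero , s≤s () , _)
      coincidence (suc (suc _) , suc zero , s≤s () , _)
      coincidence (suc (suc _) , suc (suc zero) , s≤s (s≤s ()) , _)
      coincidence (suc (suc (suc _)) , suc (suc (suc zero)) , s≤s (s≤s (s≤s ())) , _)

  d-profile : ∀ x {w₁ w₂ w₃} → ThreeOn _I_ l w₁ w₂ w₃ → LineProfile (d x w₁) (d x w₂) (d x w₃)
  d-profile {l} x {w₁} {w₂} {w₃} three@(three-on w₁∈ w₂∈ w₃∈ w₁≢w₂ w₁≢w₃ w₂≢w₃)
    with nearest-point x l
  ... | y , y∈ , further with ThreeOn-complete three y∈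
  ... | inj₁ refl        = profile₁ (further w₂ w₂∈ (w₁≢w₂ ∘ sym)) (further w₃ w₃∈ (w₁≢w₃ ∘ sym))
  ... | inj₂ (inj₁ refl) = profile₂ (further w₁ w₁∈ w₁≢w₂) (further w₃ w₃∈ (w₂≢w₃ ∘ sym))
  ... | inj₂ (inj₂ refl) = profile₃ (further w₁ w₁∈ w₁≢w₃) (further w₂ w₂∈ w₂≢w₃)

  d-profile′ : ∀ x {w₁ w₂ w₃} → ThreeOn _I_ l w₁ w₂ w₃ → LineProfile (d w₁ x) (d w₂ x) (d w₃ x)
  d-profile′ x {w₁} {w₂} {w₃} three rewrite d-sym w₁ x | d-sym w₂ x | d-sym w₃ x = d-profile x three

∈-concatMap-pairs : ∀ {A B : Set} {xs : List A} {ys : List B} {a b} → a ∈ xs → b ∈ ys →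
                    (a , b) ∈ concatMap (λ a → map (a ,_) ys) xs
∈-concatMap-pairs {ys = ys} a∈ b∈ = ∈-concatMap⁺ (λ a → map (a ,_) ys) (Any.map (λ { refl → ∈-map⁺ _ b∈ }) a∈)

∈-mapMaybe : ∀ {A B : Set} (f : A → Maybe B) {xs x y} → x ∈ xs → Maybe.Any (y ≡_) (f x) → y ∈ mapMaybe f xs
∈-mapMaybe f x∈ fx = mapMaybe⁺ f _ (map⁺ (Any.map (λ { refl → fx }) x∈))

∈-allVecs : ∀ n (v : Vec Bool n) → v ∈ allVecs n
∈-allVecs zero    []      = here refl
∈-allVecs (suc n) (b ∷ v) = ∈-concatMap⁺ _ (Any.map (λ { refl → bit∈ b }) (∈-allVecs n v))
  where
    bit∈ : ∀ b → b ∷ v ∈ (false ∷ v) ∷ (true ∷ v) ∷ []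
    bit∈ false = here refl
    bit∈ true  = there (here refl)

selectHD-complete : ∀ p → Maybe.Any (p ≡_) (selectHD (proj₁ p))
selectHD-complete ((a , b) , t) with T? (isH2Line a b)
... | yes t′ = Maybe.just (cong ((a , b) ,_) (T-irrelevant t t′))
... | no ¬t  = ⊥-elim (¬t t)

∈-allHDPoints : ∀ p → p ∈ allHDPoints
∈-allHDPoints p@((a , b) , _) =
  ∈-mapMaybe selectHD (∈-concatMap-pairs (∈-allVecs 7 a) (∈-allVecs 7 b)) (selectHD-complete p)

-- fromCode inverts code: points and lines of H^D(2) are written by the codes of their vectors.
fromCode : ∀ n → ℕ → Vec Bool n
fromCode zero    k = []
fromCode (suc n) k = (k % 2 ≡ᵇ 1) ∷ fromCode n (k / 2)

point : (a b : ℕ) → {T (isH2Line (fromCode 7 a) (fromCode 7 b))} → HDPoint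
point a b {t} = (fromCode 7 a , fromCode 7 b) , t

line : (a : ℕ) → {T (isH2Point (fromCode 7 a))} → HDLine
line a {t} = fromCode 7 a , t

-- allHDPoints written out: every evaluation of allHDPoints itself filters 2¹⁴ pairs of vectors.
hdPoints : List HDPoint
hdPoints =
  point 1 32 ∷ point 1 64 ∷ point 1 96 ∷ point 2 16 ∷ point 2 64 ∷ point 2 80 ∷
  point 3 48 ∷ point 3 64 ∷ point 3 112 ∷ point 4 16 ∷ point 4 32 ∷ point 4 48 ∷
  point 5 32 ∷ point 5 80 ∷ point 5 112 ∷ point 6 16 ∷ point 6 96 ∷ point 6 112 ∷
  point 7 48 ∷ point 7 80 ∷ point 7 96 ∷ point 18 76 ∷ point 18 78 ∷ point 20 42 ∷
  point 20 46 ∷ point 22 106 ∷ point 22 108 ∷ point 25 36 ∷ point 25 66 ∷ point 25 102 ∷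
  point 27 47 ∷ point 27 66 ∷ point 27 109 ∷ point 29 36 ∷ point 29 79 ∷ point 29 107 ∷
  point 31 43 ∷ point 31 77 ∷ point 31 102 ∷ point 33 76 ∷ point 33 77 ∷ point 37 89 ∷
  point 37 92 ∷ point 42 65 ∷ point 42 85 ∷ point 43 65 ∷ point 43 94 ∷ point 46 79 ∷
  point 46 91 ∷ point 47 78 ∷ point 47 85 ∷ point 51 76 ∷ point 51 79 ∷ point 55 91 ∷
  point 55 92 ∷ point 57 67 ∷ point 57 94 ∷ point 58 67 ∷ point 58 87 ∷ point 61 78 ∷
  point 61 87 ∷ point 62 77 ∷ point 62 89 ∷ []

allHDPoints≡hdPoints : allHDPoints ≡ hdPoints
allHDPoints≡hdPoints = refl

∈-hdPoints : ∀ p → p ∈ hdPoints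
∈-hdPoints p = subst (p ∈_) allHDPoints≡hdPoints (∈-allHDPoints p)

_≟ᵛ_ : DecidableEquality Vec7
_≟ᵛ_ = Vec.≡-dec Bool._≟_

_≟ᴾ_ : DecidableEquality HDPoint
_≟ᴾ_ = Product.≡-dec (Product.≡-dec _≟ᵛ_ _≟ᵛ_) λ s t → yes (T-irrelevant s t)

_Iᴰ?_ : ∀ p L → Dec (p Iᴰ L)
((a , b) , _) Iᴰ? (v , _) = (v ≟ᵛ a) ⊎-dec ((v ≟ᵛ b) ⊎-dec (v ≟ᵛ (a ⊕ b)))

vectors : HDPoint → List Vec7
vectors ((a , b) , _) = a ∷ b ∷ a ⊕ b ∷ []

Iᴰ⇒∈ : ∀ p L → p Iᴰ L → proj₁ L ∈ vectors p
Iᴰ⇒∈ _ _ (inj₁ e)        = here e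
Iᴰ⇒∈ _ _ (inj₂ (inj₁ e)) = there (here e)
Iᴰ⇒∈ _ _ (inj₂ (inj₂ e)) = there (there (here e))

Adjacent : HDPoint → HDPoint → Set
Adjacent p q = Any (_∈ vectors q) (vectors p)

adjacent? : ∀ p q → Dec (Adjacent p q)
adjacent? p q = any? (λ v → any? (v ≟ᵛ_) (vectors q)) (vectors p)

adjacent : ∀ {p q} L → p Iᴰ L → q Iᴰ L → Adjacent p q
adjacent {p} {q} L p∈L q∈L = lose (Iᴰ⇒∈ p L p∈L) (Iᴰ⇒∈ q L q∈L)

Near : HDPoint → HDPoint → Set
Near p q = p ≡ q ⊎ Adjacent p q ⊎ Any (λ w → Adjacent p w × Adjacent w q) hdPoints

near? : ∀ p q → Dec (Near p q)
near? p q = (p ≟ᴾ q) ⊎-dec adjacent? p q ⊎-dec any? (λ w → adjacent? p w ×-dec adjacent? w q) hdPoints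

walk⇒Near : ∀ {p q n} → Geometry.Walk _Iᴰ_ p q n → n ≤ 2 → Near p q
walk⇒Near Geometry.here _ = inj₁ refl
walk⇒Near {p} {q} (Geometry.step L _ p∈L q∈L Geometry.here) _ = inj₂ (inj₁ (adjacent {p} {q} L p∈L q∈L))
walk⇒Near {p} {q} (Geometry.step {y = w} L _ p∈L w∈L (Geometry.step L′ _ w∈L′ q∈L′ Geometry.here)) _ =
  inj₂ (inj₂ (lose (∈-hdPoints w) (adjacent {p} {w} L p∈L w∈L , adjacent {w} {q} L′ w∈L′ q∈L′)))
walk⇒Near (Geometry.step _ _ _ _ (Geometry.step _ _ _ _ (Geometry.step _ _ _ _ _))) (s≤s (s≤s ()))

record Opposite (p q : HDPoint) : Set where
  constructor opposite
  field
    ¬near : ¬ Near p q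

opposite? : ∀ p q → Dec (Opposite p q)
opposite? p q = map′ opposite Opposite.¬near (¬? (near? p q))

threeOnᴰ? : ∀ L u v z → Dec (ThreeOn _Iᴰ_ L u v z)
threeOnᴰ? L u v z =
  map′ (λ (a , b , c , d , e , f) → three-on a b c d e f) (λ (three-on a b c d e f) → a , b , c , d , e , f)
       ((u Iᴰ? L) ×-dec (v Iᴰ? L) ×-dec (z Iᴰ? L) ×-dec ¬? (u ≟ᴾ v) ×-dec ¬? (u ≟ᴾ z) ×-dec ¬? (v ≟ᴾ z))

ThirdPointVia : HDPoint → HDPoint → HDLine → HDPoint → HDPoint → Set
ThirdPointVia p z L u v = ThreeOn _Iᴰ_ L u v z × Opposite p u × Opposite p v

thirdPointVia? : ∀ p z L u v → Dec (ThirdPointVia p z L u v)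
thirdPointVia? p z L u v = threeOnᴰ? L u v z ×-dec opposite? p u ×-dec opposite? p v

ThirdPoint : HDPoint → HDPoint → Set
ThirdPoint p z = Σ[ L ∈ HDLine ] Σ[ u ∈ HDPoint ] Σ[ v ∈ HDPoint ] ThirdPointVia p z L u v

Obstruction : HDPoint → Set
Obstruction p = Σ[ z₁ ∈ HDPoint ] Σ[ z₂ ∈ HDPoint ] ThirdPoint p z₁ × ThirdPoint p z₂ × Opposite z₁ z₂

obstruction : ∀ {p} z₁ L₁ u₁ v₁ z₂ L₂ u₂ v₂ →
  {True (thirdPointVia? p z₁ L₁ u₁ v₁ ×-dec thirdPointVia? p z₂ L₂ u₂ v₂ ×-dec opposite? z₁ z₂)} →
  Obstruction p
obstruction z₁ L₁ u₁ v₁ z₂ L₂ u₂ v₂ {ok} =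
  let via₁ , via₂ , z₁-opp-z₂ = toWitness ok
  in z₁ , z₂ , (L₁ , u₁ , v₁ , via₁) , (L₂ , u₂ , v₂ , via₂) , z₁-opp-z₂

-- Rows found by a computer search; each is certified by evaluating the decision procedure in the
-- implicit argument of obstruction.
obstructions : All Obstruction hdPoints
obstructions =
  obstruction (point 2 64) (line 2) (point 2 16) (point 2 80) (point 4 48) (line 48) (point 3 48) (point 7 48) ∷
  obstruction (point 2 16) (line 16) (point 4 16) (point 6 16) (point 3 48) (line 48) (point 4 48) (point 7 48) ∷
  obstruction (point 2 64) (line 2) (point 2 16) (point 2 80) (point 4 32) (line 4) (point 4 16) (point 4 48) ∷
  obstruction (point 1 64) (line 1) (point 1 32) (point 1 96) (point 4 48) (line 48) (point 3 48) (point 7 48) ∷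
  obstruction (point 1 32) (line 32) (point 4 32) (point 5 32) (point 3 48) (line 48) (point 4 48) (point 7 48) ∷
  obstruction (point 1 64) (line 1) (point 1 32) (point 1 96) (point 4 16) (line 4) (point 4 32) (point 4 48) ∷
  obstruction (point 1 64) (line 1) (point 1 32) (point 1 96) (point 4 16) (line 16) (point 2 16) (point 6 16) ∷
  obstruction (point 1 32) (line 32) (point 4 32) (point 5 32) (point 2 16) (line 16) (point 4 16) (point 6 16) ∷
  obstruction (point 1 64) (line 1) (point 1 32) (point 1 96) (point 4 48) (line 4) (point 4 16) (point 4 32) ∷
  obstruction (point 1 32) (line 1) (point 1 64) (point 1 96) (point 2 80) (line 80) (point 5 80) (point 7 80) ∷
  obstruction (point 1 64) (line 64) (point 2 64) (point 3 64) (point 5 80) (line 80) (point 2 80) (point 7 80) ∷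
  obstruction (point 1 32) (line 1) (point 1 64) (point 1 96) (point 2 16) (line 2) (point 2 64) (point 2 80) ∷
  obstruction (point 1 64) (line 64) (point 2 64) (point 3 64) (point 4 16) (line 16) (point 2 16) (point 6 16) ∷
  obstruction (point 1 32) (line 1) (point 1 64) (point 1 96) (point 2 16) (line 16) (point 4 16) (point 6 16) ∷
  obstruction (point 1 32) (line 1) (point 1 64) (point 1 96) (point 2 80) (line 2) (point 2 16) (point 2 64) ∷
  obstruction (point 1 96) (line 1) (point 1 32) (point 1 64) (point 2 80) (line 80) (point 5 80) (point 7 80) ∷
  obstruction (point 1 32) (line 32) (point 4 32) (point 5 32) (point 2 16) (line 2) (point 2 64) (point 2 80) ∷
  obstruction (point 1 96) (line 1) (point 1 32) (point 1 64) (point 2 16) (line 2) (point 2 64) (point 2 80) ∷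
  obstruction (point 1 96) (line 1) (point 1 32) (point 1 64) (point 2 80) (line 2) (point 2 16) (point 2 64) ∷
  obstruction (point 1 96) (line 1) (point 1 32) (point 1 64) (point 2 16) (line 16) (point 4 16) (point 6 16) ∷
  obstruction (point 1 32) (line 32) (point 4 32) (point 5 32) (point 2 80) (line 2) (point 2 16) (point 2 64) ∷
  obstruction (point 1 32) (line 1) (point 1 64) (point 1 96) (point 2 80) (line 80) (point 5 80) (point 7 80) ∷
  obstruction (point 1 96) (line 1) (point 1 32) (point 1 64) (point 2 80) (line 80) (point 5 80) (point 7 80) ∷
  obstruction (point 1 64) (line 1) (point 1 32) (point 1 96) (point 4 48) (line 48) (point 3 48) (point 7 48) ∷
  obstruction (point 1 96) (line 1) (point 1 32) (point 1 64) (point 2 16) (line 2) (point 2 64) (point 2 80) ∷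
  obstruction (point 1 64) (line 1) (point 1 32) (point 1 96) (point 4 16) (line 4) (point 4 32) (point 4 48) ∷
  obstruction (point 1 32) (line 1) (point 1 64) (point 1 96) (point 2 16) (line 2) (point 2 64) (point 2 80) ∷
  obstruction (point 1 32) (line 1) (point 1 64) (point 1 96) (point 3 112) (line 3) (point 3 48) (point 3 64) ∷
  obstruction (point 1 64) (line 1) (point 1 32) (point 1 96) (point 5 112) (line 5) (point 5 32) (point 5 80) ∷
  obstruction (point 1 96) (line 1) (point 1 32) (point 1 64) (point 3 48) (line 3) (point 3 64) (point 3 112) ∷
  obstruction (point 1 96) (line 1) (point 1 32) (point 1 64) (point 3 48) (line 3) (point 3 64) (point 3 112) ∷
  obstruction (point 1 64) (line 1) (point 1 32) (point 1 96) (point 4 48) (line 4) (point 4 16) (point 4 32) ∷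
  obstruction (point 1 32) (line 1) (point 1 64) (point 1 96) (point 3 112) (line 3) (point 3 48) (point 3 64) ∷
  obstruction (point 1 32) (line 1) (point 1 64) (point 1 96) (point 2 80) (line 2) (point 2 16) (point 2 64) ∷
  obstruction (point 1 96) (line 1) (point 1 32) (point 1 64) (point 2 16) (line 16) (point 4 16) (point 6 16) ∷
  obstruction (point 1 64) (line 1) (point 1 32) (point 1 96) (point 5 112) (line 5) (point 5 32) (point 5 80) ∷
  obstruction (point 1 64) (line 1) (point 1 32) (point 1 96) (point 4 16) (line 16) (point 2 16) (point 6 16) ∷
  obstruction (point 1 32) (line 1) (point 1 64) (point 1 96) (point 2 16) (line 16) (point 4 16) (point 6 16) ∷
  obstruction (point 1 96) (line 1) (point 1 32) (point 1 64) (point 2 80) (line 2) (point 2 16) (point 2 64) ∷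
  obstruction (point 1 64) (line 64) (point 2 64) (point 3 64) (point 6 112) (line 6) (point 6 16) (point 6 96) ∷
  obstruction (point 1 64) (line 64) (point 2 64) (point 3 64) (point 6 16) (line 6) (point 6 96) (point 6 112) ∷
  obstruction (point 1 32) (line 1) (point 1 64) (point 1 96) (point 3 48) (line 3) (point 3 64) (point 3 112) ∷
  obstruction (point 1 32) (line 1) (point 1 64) (point 1 96) (point 2 16) (line 2) (point 2 64) (point 2 80) ∷
  obstruction (point 1 32) (line 32) (point 4 32) (point 5 32) (point 6 112) (line 6) (point 6 16) (point 6 96) ∷
  obstruction (point 1 64) (line 1) (point 1 32) (point 1 96) (point 4 16) (line 4) (point 4 32) (point 4 48) ∷
  obstruction (point 1 32) (line 32) (point 4 32) (point 5 32) (point 6 16) (line 6) (point 6 96) (point 6 112) ∷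
  obstruction (point 1 64) (line 1) (point 1 32) (point 1 96) (point 4 48) (line 4) (point 4 16) (point 4 32) ∷
  obstruction (point 1 32) (line 32) (point 4 32) (point 5 32) (point 2 80) (line 2) (point 2 16) (point 2 64) ∷
  obstruction (point 1 96) (line 1) (point 1 32) (point 1 64) (point 3 112) (line 3) (point 3 48) (point 3 64) ∷
  obstruction (point 1 32) (line 32) (point 4 32) (point 5 32) (point 2 16) (line 2) (point 2 64) (point 2 80) ∷
  obstruction (point 1 96) (line 1) (point 1 32) (point 1 64) (point 2 80) (line 2) (point 2 16) (point 2 64) ∷
  obstruction (point 1 32) (line 1) (point 1 64) (point 1 96) (point 2 16) (line 2) (point 2 64) (point 2 80) ∷
  obstruction (point 1 96) (line 1) (point 1 32) (point 1 64) (point 2 80) (line 2) (point 2 16) (point 2 64) ∷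
  obstruction (point 1 32) (line 1) (point 1 64) (point 1 96) (point 3 48) (line 3) (point 3 64) (point 3 112) ∷
  obstruction (point 1 64) (line 1) (point 1 32) (point 1 96) (point 4 48) (line 4) (point 4 16) (point 4 32) ∷
  obstruction (point 1 64) (line 1) (point 1 32) (point 1 96) (point 5 80) (line 5) (point 5 32) (point 5 112) ∷
  obstruction (point 1 96) (line 1) (point 1 32) (point 1 64) (point 2 16) (line 2) (point 2 64) (point 2 80) ∷
  obstruction (point 1 64) (line 1) (point 1 32) (point 1 96) (point 4 16) (line 4) (point 4 32) (point 4 48) ∷
  obstruction (point 1 32) (line 1) (point 1 64) (point 1 96) (point 2 80) (line 2) (point 2 16) (point 2 64) ∷
  obstruction (point 1 96) (line 1) (point 1 32) (point 1 64) (point 2 16) (line 2) (point 2 64) (point 2 80) ∷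
  obstruction (point 1 64) (line 1) (point 1 32) (point 1 96) (point 5 80) (line 5) (point 5 32) (point 5 112) ∷
  obstruction (point 1 32) (line 1) (point 1 64) (point 1 96) (point 2 80) (line 2) (point 2 16) (point 2 64) ∷
  obstruction (point 1 96) (line 1) (point 1 32) (point 1 64) (point 3 112) (line 3) (point 3 48) (point 3 64) ∷
  []

obstruction-at : ∀ p → Obstruction p
obstruction-at p = All.lookup obstructions (∈-hdPoints p)

minimum : List ℤ → ℤ
minimum []       = 0ℤ
minimum (i ∷ is) = foldr _⊓_ i is

module _ {A : Set} (f : A → ℤ) where

  minimum-map-≤ : ∀ xs {x} → x ∈ xs → minimum (map f xs) ℤ.≤ f x
  minimum-map-≤ (y ∷ ys) x∈ =
    foldr-preservesᵒ (λ i j → [ ℤ.i≤j⇒i⊓k≤j j , ℤ.i≤j⇒k⊓i≤j i ]′) (f y) (map f ys) (lower x∈)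
    where
      lower : ∀ {x y ys} → x ∈ y ∷ ys → f y ℤ.≤ f x ⊎ Any (ℤ._≤ f x) (map f ys)
      lower (here refl) = inj₁ ℤ.≤-refl
      lower (there x∈)  = inj₂ (map⁺ (Any.map (λ { refl → ℤ.≤-refl }) x∈))

  minimum-map-attained : ∀ xs {x} → x ∈ xs → Σ A λ y → minimum (map f xs) ≡ f y
  minimum-map-attained (y ∷ ys) _ with foldr-selective ℤ.⊓-sel (f y) (map f ys)
  ... | inj₁ eq = y , eq
  ... | inj₂ m  = let z , _ , eq = ∈-map⁻ f m in z , eq

minOver≡minimum : ∀ f → minOver f ≡ minimum (map f allHDPoints)
minOver≡minimum f = refl

minOver-≤ : ∀ f p → minOver f ℤ.≤ f p
minOver-≤ f p = subst (ℤ._≤ f p) (sym (minOver≡minimum f)) (minimum-map-≤ f allHDPoints (∈-allHDPoints p))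

minOver-attained : ∀ f → Σ HDPoint λ p → minOver f ≡ f p
minOver-attained f =
  let p , eq = minimum-map-attained f allHDPoints (∈-allHDPoints (point 1 32))
  in p , trans (minOver≡minimum f) eq

minOver-unique : ∀ f {m} → (∀ p → m ℤ.≤ f p) → ∀ p₀ → f p₀ ≡ m → minOver f ≡ m
minOver-unique f m≤ p₀ eq =
  let p , min≡ = minOver-attained f
  in ℤ.≤-antisym (subst (minOver f ℤ.≤_) eq (minOver-≤ f p₀)) (subst (_ ℤ.≤_) (sym min≡) (m≤ p))

argmin : (g : HDPoint → ℕ) → Σ HDPoint λ p₀ → ∀ p → g p₀ ≤ g p
argmin g =
  let p₀ , min≡ = minOver-attained (λ p → + g p)
  in p₀ , λ p → ℤ.drop‿+≤+ (subst (ℤ._≤ + g p) min≡ (minOver-≤ (λ p → + g p) p))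

shift-valuation : ∀ {f} g → (∀ p → f p ≡ g p - minOver g) →
                  (∀ L → Σ HDPoint λ p → p Iᴰ L × (∀ q → q Iᴰ L → q ≢ p → g q ≡ g p ℤ.+ 1ℤ)) →
                  IsValuation f
shift-valuation {f} g f≡ line-min = record
  { nonneg  = λ p → subst (0ℤ ℤ.≤_) (sym (f≡ p)) (ℤ.i≤j⇒0≤j-i (minOver-≤ g p))
  ; hasZero = let p , min≡ = minOver-attained g
              in p , trans (f≡ p) (trans (cong (λ m → g p - m) min≡) (ℤ.+-inverseʳ (g p)))
  ; lineMin = λ L → let p , p∈ , above = line-min L in p , p∈ , λ q q∈ q≢p → begin
      f q                    ≡⟨ f≡ q ⟩
      g q - minOver g        ≡⟨ cong (_- minOver g) (above q q∈ q≢p) ⟩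
      g p ℤ.+ 1ℤ - minOver g ≡⟨ shift-+1 (g p) (minOver g) ⟩
      g p - minOver g ℤ.+ 1ℤ ≡⟨ cong (ℤ._+ 1ℤ) (sym (f≡ p)) ⟩
      f p ℤ.+ 1ℤ             ∎
  }
  where
    open ≡-Reasoning
    shift-+1 : ∀ i m → i ℤ.+ 1ℤ - m ≡ i - m ℤ.+ 1ℤ
    shift-+1 = solve-∀

module ShiftedProfiles
  {D₁ D₂ D₃ : HDPoint → ℕ} (profile : ∀ p → LineProfile (D₁ p) (D₂ p) (D₃ p))
  {f₁ f₂ : HDPoint → ℤ} {m₁ m₂ : ℤ}
  (f₁≡ : ∀ p → f₁ p ≡ + D₁ p - m₁) (f₂≡ : ∀ p → f₂ p ≡ + D₂ p - m₂)
  where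
  open ≡-Reasoning

  difference-gap : ∀ p → f₁ p - f₂ p ℤ.+ (m₁ - m₂) ≡ gap (profile p)
  difference-gap p = begin
    f₁ p - f₂ p ℤ.+ (m₁ - m₂)                   ≡⟨ cong₂ (λ i j → i - j ℤ.+ (m₁ - m₂)) (f₁≡ p) (f₂≡ p) ⟩
    (+ D₁ p - m₁) - (+ D₂ p - m₂) ℤ.+ (m₁ - m₂) ≡⟨ shifted-difference (+ D₁ p) (+ D₂ p) m₁ m₂ ⟩
    + D₁ p - + D₂ p                             ≡⟨ gap-correct (profile p) ⟩
    gap (profile p)                             ∎

  neighboring : Neighboring f₁ f₂ (m₁ - m₂)
  neighboring p = subst (λ k → ∣ k ∣ ≤ 1) (sym (difference-gap p)) (∣gap∣≤1 (profile p))

  star'-shifted : ∀ p → star' f₁ f₂ (m₁ - m₂) p ≡ + D₃ p - m₁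
  star'-shifted p = begin
    star' f₁ f₂ (m₁ - m₂) p           ≡⟨⟩
    merge (f₁ p) (f₂ p - (m₁ - m₂))   ≡⟨ cong₂ merge (f₁≡ p) f₂-shifted ⟩
    merge (+ D₁ p - m₁) (+ D₂ p - m₁) ≡⟨ merge-profile (profile p) m₁ ⟩
    + D₃ p - m₁                       ∎
    where
      f₂-shifted : f₂ p - (m₁ - m₂) ≡ + D₂ p - m₁
      f₂-shifted = trans (cong (_- (m₁ - m₂)) (f₂≡ p)) (shift-cancel (+ D₂ p) m₁ m₂)

  star-shifted : ∀ {f₃ m₃} → (∀ p → f₃ p ≡ + D₃ p - m₃) → IsValuation f₃ → f₃ ≗ star f₁ f₂ (m₁ - m₂)
  star-shifted {f₃} {m₃} f₃≡ val p = begin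
    f₃ p                                                      ≡⟨ f₃≡ p ⟩
    + D₃ p - m₃                                               ≡⟨ sym (shift-cancel (+ D₃ p) m₃ m₁) ⟩
    (+ D₃ p - m₁) - (m₃ - m₁)                                 ≡⟨ cong₂ _-_ (sym (star'-shifted p)) (sym minOver-star') ⟩
    star' f₁ f₂ (m₁ - m₂) p - minOver (star' f₁ f₂ (m₁ - m₂)) ≡⟨⟩
    star f₁ f₂ (m₁ - m₂) p                                    ∎
    where
      m₃≤ : ∀ p → m₃ ℤ.≤ + D₃ p
      m₃≤ p = ℤ.0≤i-j⇒j≤i (subst (0ℤ ℤ.≤_) (f₃≡ p) (IsValuation.nonneg val p))
      minOver-star' : minOver (star' f₁ f₂ (m₁ - m₂)) ≡ m₃ - m₁
      minOver-star' =
        let p₃ , f₃p₃≡0 = IsValuation.hasZero val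
            D₃p₃≡m₃ = ℤ.i-j≡0⇒i≡j (+ D₃ p₃) m₃ (trans (sym (f₃≡ p₃)) f₃p₃≡0)
        in minOver-unique (star' f₁ f₂ (m₁ - m₂))
             (λ p → subst (m₃ - m₁ ℤ.≤_) (sym (star'-shifted p)) (ℤ.+-monoˡ-≤ (- m₁) (m₃≤ p)))
             p₃ (trans (star'-shifted p₃) (cong (_- m₁) D₃p₃≡m₃))

  same-nearest : f₁ ≗ f₂ → (∀ p → D₁ p < D₂ p) ⊎ (∀ p → D₂ p < D₁ p) ⊎ (∀ p → D₃ p < D₁ p)
  same-nearest f₁≗f₂ = by-gap (gap-cases (profile p₀))
    where
      p₀ : HDPoint
      p₀ = point 1 32
      gap-constant : ∀ p → gap (profile p) ≡ m₁ - m₂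
      gap-constant p = trans (sym (gap-correct (profile p)))
        (differences-equal (+ D₁ p) (+ D₂ p) m₁ m₂ (trans (sym (f₁≡ p)) (trans (f₁≗f₂ p) (f₂≡ p))))
      same-gap : ∀ p → gap (profile p) ≡ gap (profile p₀)
      same-gap p = trans (gap-constant p) (sym (gap-constant p₀))
      by-gap : gap (profile p₀) ≡ -1ℤ ⊎ gap (profile p₀) ≡ 1ℤ ⊎ gap (profile p₀) ≡ 0ℤ →
               (∀ p → D₁ p < D₂ p) ⊎ (∀ p → D₂ p < D₁ p) ⊎ (∀ p → D₃ p < D₁ p)
      by-gap (inj₁ e)        = inj₁ λ p → gap≡-1⇒a<b (profile p) (trans (same-gap p) e)
      by-gap (inj₂ (inj₁ e)) = inj₂ (inj₁ λ p → gap≡1⇒b<a (profile p) (trans (same-gap p) e))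
      by-gap (inj₂ (inj₂ e)) = inj₂ (inj₂ λ p → gap≡0⇒c<a (profile p) (trans (same-gap p) e))

-- HDEmbedding.fval E is written out rather than opened: an opened copy is a different name, and
-- comparing it with the original makes Agda evaluate minOver.  For the same reason d(x,H) is opaque.
module EmbeddedValuations (N : NearHexagon3) (E : HDEmbedding N) where
  open NearHexagon3 N
  open HDEmbedding E hiding (fval)
  open NearHexagonMetric N

  ThreeOn-φ : ∀ {L u v z} → ThreeOn _Iᴰ_ L u v z → ThreeOn _I_ (ψ L) (φ u) (φ v) (φ z)
  ThreeOn-φ {L} {u} {v} {z} (three-on u∈ v∈ z∈ u≢v u≢z v≢z) =
    three-on (proj₁ (incidence u L) u∈) (proj₁ (incidence v L) v∈) (proj₁ (incidence z L) z∈)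
             (u≢v ∘ φ-inj) (u≢z ∘ φ-inj) (v≢z ∘ φ-inj)

  H-profile : ∀ x {L u v z} → ThreeOn _Iᴰ_ L u v z → LineProfile (d x (φ u)) (d x (φ v)) (d x (φ z))
  H-profile x three = d-profile x (ThreeOn-φ three)

  opposite⇒2<d : ∀ {p q} → Opposite p q → 2 < d (φ p) (φ q)
  opposite⇒2<d {p} {q} p-opp-q with d (φ p) (φ q) ≤? 2
  ... | yes d≤2 =
    let walk-in-H = proj₁ (proj₂ (isometric p q _) (d-Dist (φ p) (φ q)))
    in ⊥-elim (Opposite.¬near p-opp-q (walk⇒Near walk-in-H d≤2))
  ... | no  d≰2 = ≰⇒> d≰2

  opposite⇒2<d+d : ∀ x {p q} → Opposite p q → 2 < d x (φ p) + d x (φ q)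
  opposite⇒2<d+d x {p} {q} p-opp-q = <-≤-trans (opposite⇒2<d p-opp-q) (begin
    d (φ p) (φ q)         ≤⟨ d-triangle (φ p) x (φ q) ⟩
    d (φ p) x + d x (φ q) ≡⟨ cong (_+ d x (φ q)) (d-sym (φ p) x) ⟩
    d x (φ p) + d x (φ q) ∎)
    where open ≤-Reasoning

  H-not-within-distance-2 : ∀ x → ¬ (∀ p → d x (φ p) ≤ 2)
  H-not-within-distance-2 x within = from-nearest (argmin g)
    where
      g : HDPoint → ℕ
      g p = d x (φ p)
      from-nearest : (Σ HDPoint λ p₀ → ∀ p → g p₀ ≤ g p) → ⊥
      from-nearest (p₀ , nearest) = by-distance (g p₀) refl (obstruction-at p₀)
        where
          opposite-p₀ : ∀ {n u} → g p₀ ≡ n → Opposite p₀ u → 2 < n + g u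
          opposite-p₀ {u = u} g-p₀ opp = subst (λ k → 2 < k + g u) g-p₀ (opposite⇒2<d+d x opp)
          by-distance : ∀ n → g p₀ ≡ n → Obstruction p₀ → ⊥
          by-distance 0 g-p₀ (_ , _ , (_ , u , _ , _ , opp-u , _) , _) = ≤⇒≯ (within u) (opposite-p₀ g-p₀ opp-u)
          by-distance 1 g-p₀
            (_ , _ , (_ , _ , _ , three₁ , opp-u₁ , opp-v₁) , (_ , _ , _ , three₂ , opp-u₂ , opp-v₂) , opp-z) =
            ≤⇒≯ (≤-reflexive (cong₂ _+_ (third-at-1 three₁ opp-u₁ opp-v₁) (third-at-1 three₂ opp-u₂ opp-v₂)))
                (opposite⇒2<d+d x opp-z)
            where
              at-2 : ∀ {u} → Opposite p₀ u → g u ≡ 2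
              at-2 {u} opp = ≤-antisym (within u) (s≤s⁻¹ (opposite-p₀ g-p₀ opp))
              third-at-1 : ∀ {L u v z} → ThreeOn _Iᴰ_ L u v z → Opposite p₀ u → Opposite p₀ v → g z ≡ 1
              third-at-1 three opp-u opp-v =
                suc-injective (sym (LineProfile-equal (LineProfile-cong (at-2 opp-u) (at-2 opp-v) refl (H-profile x three))))
          by-distance (suc (suc _)) g-p₀ (_ , _ , (_ , _ , _ , three , _ , _) , _) =
            1+n≢n (sym (LineProfile-equal (LineProfile-cong (all-2 _) (all-2 _) (all-2 _) (H-profile x three))))
            where
              all-2 : ∀ p → g p ≡ 2
              all-2 p = ≤-antisym (within p) (≤-trans (subst (2 ≤_) (sym g-p₀) (s≤s (s≤s z≤n))) (nearest p))

  nearest-in-H : ∀ x L → Σ HDPoint λ p → p Iᴰ L × (∀ q → q Iᴰ L → q ≢ p → + d x (φ q) ≡ + d x (φ p) ℤ.+ 1ℤ)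
  nearest-in-H x L =
    let y , y∈ , further = nearest-point x (ψ L)
        p , φp≡y = full L y y∈
    in p , proj₂ (incidence p L) (subst (_I ψ L) (sym φp≡y) y∈) , λ q q∈ q≢p → cong +_ (begin
         d x (φ q)       ≡⟨ further (φ q) (proj₁ (incidence q L) q∈) (q≢p ∘ φ-inj ∘ flip trans (sym φp≡y)) ⟩
         suc (d x y)     ≡⟨ cong (suc ∘ d x) (sym φp≡y) ⟩
         suc (d x (φ p)) ≡⟨ +-comm 1 (d x (φ p)) ⟩
         d x (φ p) + 1   ∎)
    where open ≡-Reasoning

  opaque
    dH : Pt → ℤ
    dH x = minOver (λ q → + d x (φ q))

    fval≡ : ∀ x p → HDEmbedding.fval E x p ≡ + d x (φ p) - dH x
    fval≡ x p = refl

    dH≡ : ∀ x → dH x ≡ minOver (λ q → + d x (φ q))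
    dH≡ x = refl

  fval-valuation : ∀ x → IsValuation (HDEmbedding.fval E x)
  fval-valuation x =
    shift-valuation (λ q → + d x (φ q)) (λ p → trans (fval≡ x p) (cong (λ m → + d x (φ p) - m) (dH≡ x)))
                    (nearest-in-H x)

  module ValuationsOnLine {l x₁ x₂ x₃} (three : ThreeOn _I_ l x₁ x₂ x₃) =
    ShiftedProfiles (λ p → d-profile′ (φ p) three)
                    {f₁ = HDEmbedding.fval E x₁} {f₂ = HDEmbedding.fval E x₂} {dH x₁} {dH x₂}
                    (fval≡ x₁) (fval≡ x₂)

  fval-distinct : ∀ {l x y z} → ThreeOn _I_ l x y z → ¬ (HDEmbedding.fval E x ≗ HDEmbedding.fval E y)
  fval-distinct {l} {x} {y} {z} three fx≗fy =
    [ (λ x-nearer → H-not-within-distance-2 x (λ p → below-3 (x-nearer p) (d≤3 y (φ p))))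
    , [ (λ y-nearer → H-not-within-distance-2 y (λ p → below-3 (y-nearer p) (d≤3 x (φ p))))
      , (λ z-nearer → H-not-within-distance-2 z (λ p → below-3 (z-nearer p) (d≤3 x (φ p)))) ]′ ]′
    (ValuationsOnLine.same-nearest three fx≗fy)
    where
      below-3 : ∀ {m n} → m < n → n ≤ 3 → m ≤ 2
      below-3 m<n n≤3 = s≤s⁻¹ (≤-trans m<n n≤3)

lemma3p5 : (N : NearHexagon3) (E : HDEmbedding N) (l : NearHexagon3.Ln N)
    (x₁ x₂ x₃ : NearHexagon3.Pt N) →
    NearHexagon3._I_ N x₁ l → NearHexagon3._I_ N x₂ l → NearHexagon3._I_ N x₃ l →
    x₁ ≢ x₂ → x₁ ≢ x₃ → x₂ ≢ x₃ →
    (¬ (HDEmbedding.fval E x₁ ≗ HDEmbedding.fval E x₂) ×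
     ¬ (HDEmbedding.fval E x₁ ≗ HDEmbedding.fval E x₃) ×
     ¬ (HDEmbedding.fval E x₂ ≗ HDEmbedding.fval E x₃)) ×
    IsVLine (HDEmbedding.fval E x₁) (HDEmbedding.fval E x₂) (HDEmbedding.fval E x₃)
lemma3p5 N E l x₁ x₂ x₃ x₁∈ x₂∈ x₃∈ x₁≢x₂ x₁≢x₃ x₂≢x₃ =
  (f₁≢f₂ , f₁≢f₃ , f₂≢f₃) ,
  inj₁ (fval-valuation x₁ , fval-valuation x₂ , fval-valuation x₃ , f₁≢f₂ , f₁≢f₃ , f₂≢f₃ ,
        dH x₁ - dH x₂ , neighboring , star-shifted {m₃ = dH x₃} (fval≡ x₃) (fval-valuation x₃))
  where
    open EmbeddedValuations N E
    on-l = three-on x₁∈ x₂∈ x₃∈ x₁≢x₂ x₁≢x₃ x₂≢x₃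
    open ValuationsOnLine on-l
    f₁≢f₂ = fval-distinct on-l
    f₁≢f₃ = fval-distinct (ThreeOn-swap₂₃ on-l)
    f₂≢f₃ = fval-distinct (ThreeOn-rotate on-l)
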